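{- Fix an integer $d\ge 1$ and consider any graph $G_t$ ($t\ge 0$) produced by the $d$-dimensional P-RAN process described in the context. Every vertex of $G_t$ has degree $k\ge d+1$, and every vertex of degree $k$ has clustering coefficient $$C(k)=\frac{d(2k-d-1)}{k(k-1)}.$$
   Context: The $d$-dimensional P-RAN process: $G_0$ is the complete graph on $d+2$ vertices and $\mathcal{C}_0$ is the set of its $(d+1)$-element vertex subsets. For each $t\ge1$ a clique $c\in\mathcal{C}_{t-1}$ is chosen (uniformly at random), a new vertex $v$ is added and joined to all $d+1$ vertices of $c$, giving $G_t$, and $\mathcal{C}_t=\mathcal{C}_{t-1}\cup\{(c\setminus\{x\})\cup\{v\}:x\in c\}$. The clustering coefficient of a vertex $v$ with $k\ge 2$ neighbours is the number of edges between neighbours of $v$ divided by $k(k-1)/2$. -}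

module Defs where

open import Data.Nat using (ℕ; zero; suc; _+_; _*_; _∸_; _<ᵇ_; _≡ᵇ_)
open import Data.Bool using (Bool; true; false; _∧_; _∨_; not; if_then_else_)
open import Data.List using (List; []; _∷_; _++_; map; upTo; foldr)
open import Data.List.Membership.Propositional using (_∈_)
open import Data.Integer using (+_)
open import Data.Rational using (ℚ; _/_; 0ℚ)

elem : ℕ → List ℕ → Bool
elem x [] = false
elem x (y ∷ ys) = (x ≡ᵇ y) ∨ elem x ys

remove : ℕ → List ℕ → List ℕ
remove x [] = []
remove x (y ∷ ys) = if x ≡ᵇ y then remove x ys else y ∷ remove x ys

count : {A : Set} → (A → Bool) → List A → ℕ
count p [] = 0
count p (x ∷ xs) = if p x then suc (count p xs) else count p xs

-- A state of the P-RAN process: vertices are 0 , … , size - 1,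
-- a symmetric adjacency relation, and the list of active (d+1)-cliques
-- (each clique given as the list of its vertices).
record State : Set where
  constructor mkState
  field
    size    : ℕ
    adj     : ℕ → ℕ → Bool
    cliques : List (List ℕ)
open State public

-- G_0: complete graph on vertices 0 , … , d+1 ; C_0: its (d+1)-subsets
initState : ℕ → State
initState d = mkState (d + 2)
  (λ u w → not (u ≡ᵇ w) ∧ (u <ᵇ d + 2) ∧ (w <ᵇ d + 2))
  (map (λ x → remove x (upTo (d + 2))) (upTo (d + 2)))

step : State → List ℕ → State
step s c = mkState (suc (size s))
  (λ u w → adj s u w ∨ ((u ≡ᵇ size s) ∧ elem w c) ∨ ((w ≡ᵇ size s) ∧ elem u c))
  (cliques s ++ map (λ x → size s ∷ remove x c) c)

data PRAN (d : ℕ) : ℕ → State → Set where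
  start : PRAN d 0 (initState d)
  grow  : ∀ {t s} (c : List ℕ) → PRAN d t s → c ∈ cliques s → PRAN d (suc t) (step s c)

degree : State → ℕ → ℕ
degree s v = count (adj s v) (upTo (size s))

nbrEdges : State → ℕ → ℕ
nbrEdges s v = foldr _+_ 0 (map (λ u → count (λ w → (u <ᵇ w) ∧ adj s v u ∧ adj s v w ∧ adj s u w) (upTo (size s))) (upTo (size s)))

-- clustering coefficient: E / (k(k-1)/2) = 2E / (k(k-1)), for k ≥ 2
-- (set to 0 when k < 2, where it is undefined; never used in that case)
clustering : State → ℕ → ℚ
clustering s v with degree s v
... | suc (suc m) = (+ (2 * nbrEdges s v)) / (suc (suc m) * suc m)
... | _ = 0ℚ

-- C(k) = d(2k-d-1) / (k(k-1)) for k ≥ 2 (0 otherwise, never used)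
Cformula : ℕ → ℕ → ℚ
Cformula d (suc (suc m)) = (+ (d * (2 * suc (suc m) ∸ d ∸ 1))) / (suc (suc m) * suc m)
Cformula d _ = 0ℚ

-- Write E(v) for the number of edges among the neighbours of v. Every vertex obeys
-- 2 E(v) + d(d+1) = 2 d deg(v), which turns 2E / (k(k−1)) into d(2k−d−1) / (k(k−1)).
-- The law is an invariant of the process. A vertex of G₀, or a vertex just added,
-- has a (d+1)-clique as neighbourhood: deg = d+1 and E = d(d+1)/2. Later a vertex
-- gains neighbours only as a member of the chosen clique, and then deg grows by 1
-- while E grows by d (the new vertex is adjacent to the d other members). For this
-- to go through one also carries along that every active clique consists of d+1
-- pairwise adjacent existing vertices.

module Submission where

open import Defs
open import Data.Bool using (Bool; true; false; _∧_; _∨_; not; if_then_else_)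
open import Data.Bool.Properties
  using (∧-zeroʳ; ∧-identityʳ; ∨-zeroʳ; ∨-identityʳ; ∧-conicalˡ; ∧-conicalʳ; ¬-not; T-≡)
open import Data.Empty using (⊥-elim)
import Data.Integer as ℤ
open import Data.List using (List; []; _∷_; _++_; map; upTo; length)
open import Data.List.Properties using (upTo-∷ʳ; map-++; length-upTo)
open import Data.List.Membership.Propositional using (_∈_)
open import Data.List.Membership.Propositional.Properties
  using (∈-++⁻; ∈-map⁻; ∈-upTo⁺; ∈-upTo⁻)
open import Data.List.Relation.Unary.Any using (here; there)
open import Data.Nat using (ℕ; zero; suc; _+_; _*_; _∸_; _<_; _≤_; _≡ᵇ_; _<ᵇ_; s≤s; s≤s⁻¹)
open import Data.Nat.Properties
open import Data.Nat.ListAction using (sum)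
open import Data.Nat.ListAction.Properties using (sum-++)
open import Data.Nat.Tactic.RingSolver using (solve-∀)
open import Data.Product using (_×_; _,_; ∃)
open import Data.Rational using (_/_)
open import Data.Sum using (inj₁; inj₂)
open import Function using (_∘_; Equivalence)
open import Relation.Binary.PropositionalEquality
open import Relation.Nullary using (yes; no)

private variable
  A : Set
  p q : A → Bool
  f g : A → ℕ
  m n : ℕ

≡ᵇ-refl : ∀ n → (n ≡ᵇ n) ≡ true
≡ᵇ-refl zero = refl
≡ᵇ-refl (suc n) = ≡ᵇ-refl n

≡ᵇ-true⇒≡ : (m ≡ᵇ n) ≡ true → m ≡ n
≡ᵇ-true⇒≡ {m} {n} eq = ≡ᵇ⇒≡ m n (Equivalence.from T-≡ eq)

≢⇒≡ᵇ-false : m ≢ n → (m ≡ᵇ n) ≡ false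
≢⇒≡ᵇ-false m≢n = ¬-not (m≢n ∘ ≡ᵇ-true⇒≡)

<ᵇ-true⇒< : (m <ᵇ n) ≡ true → m < n
<ᵇ-true⇒< {m} {n} eq = <ᵇ⇒< m n (Equivalence.from T-≡ eq)

<⇒<ᵇ-true : m < n → (m <ᵇ n) ≡ true
<⇒<ᵇ-true m<n = Equivalence.to T-≡ (<⇒<ᵇ m<n)

≤⇒<ᵇ-false : n ≤ m → (m <ᵇ n) ≡ false
≤⇒<ᵇ-false n≤m = ¬-not (λ m<n → <⇒≱ (<ᵇ-true⇒< m<n) n≤m)

≡ᵇ-sym : ∀ m n → (m ≡ᵇ n) ≡ (n ≡ᵇ m)
≡ᵇ-sym zero zero = refl
≡ᵇ-sym zero (suc n) = refl
≡ᵇ-sym (suc m) zero = refl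
≡ᵇ-sym (suc m) (suc n) = ≡ᵇ-sym m n

count-++ : ∀ (p : A → Bool) xs ys → count p (xs ++ ys) ≡ count p xs + count p ys
count-++ p [] ys = refl
count-++ p (x ∷ xs) ys with p x
... | true = cong suc (count-++ p xs ys)
... | false = count-++ p xs ys

count-cong : ∀ xs → (∀ {x} → x ∈ xs → p x ≡ q x) → count p xs ≡ count q xs
count-cong [] _ = refl
count-cong {p = p} {q = q} (x ∷ xs) eq rewrite eq (here refl) =
  cong (λ k → if q x then suc k else k) (count-cong xs (eq ∘ there))

count-none : ∀ xs → (∀ {x} → x ∈ xs → p x ≡ false) → count p xs ≡ 0
count-none [] _ = refl
count-none {p = p} (x ∷ xs) none rewrite none (here refl) = count-none xs (none ∘ there)

count-split : ∀ (p q : A → Bool) xs →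
  count p xs ≡ count (λ x → p x ∧ q x) xs + count (λ x → p x ∧ not (q x)) xs
count-split p q [] = refl
count-split p q (x ∷ xs) with p x | q x
... | false | _ = count-split p q xs
... | true | true = cong suc (count-split p q xs)
... | true | false = trans (cong suc (count-split p q xs)) (sym (+-suc _ _))

count-true : ∀ (xs : List A) → count (λ _ → true) xs ≡ length xs
count-true [] = refl
count-true (_ ∷ xs) = cong suc (count-true xs)

sum-map-indicator : ∀ (p : A → Bool) xs → sum (map (λ x → if p x then 1 else 0) xs) ≡ count p xs
sum-map-indicator p [] = refl
sum-map-indicator p (x ∷ xs) with p x
... | true = cong suc (sum-map-indicator p xs)
... | false = sum-map-indicator p xs

sum-map-cong : ∀ xs → (∀ {x} → x ∈ xs → f x ≡ g x) → sum (map f xs) ≡ sum (map g xs)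
sum-map-cong [] _ = refl
sum-map-cong (x ∷ xs) eq = cong₂ _+_ (eq (here refl)) (sum-map-cong xs (eq ∘ there))

sum-map-+ : ∀ (f g : A → ℕ) xs → sum (map (λ x → f x + g x) xs) ≡ sum (map f xs) + sum (map g xs)
sum-map-+ f g [] = refl
sum-map-+ f g (x ∷ xs) = trans (cong ((f x + g x) +_) (sum-map-+ f g xs)) (shuffle (f x) (g x) _ _)
  where
  shuffle : ∀ a b c d → a + b + (c + d) ≡ a + c + (b + d)
  shuffle = solve-∀

∈⇒elem : ∀ {x ys} → x ∈ ys → elem x ys ≡ true
∈⇒elem {x} (here refl) rewrite ≡ᵇ-refl x = refl
∈⇒elem {x} {y ∷ _} (there x∈ys) rewrite ∈⇒elem x∈ys = ∨-zeroʳ (x ≡ᵇ y)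

elem⇒∈ : ∀ {x} ys → elem x ys ≡ true → x ∈ ys
elem⇒∈ {x} (y ∷ ys) x∈ with x ≟ y
... | yes refl = here refl
... | no x≢y rewrite ≢⇒≡ᵇ-false x≢y = there (elem⇒∈ ys x∈)

elem-upTo : ∀ u n → elem u (upTo n) ≡ (u <ᵇ n)
elem-upTo u n with u <? n
... | yes u<n = trans (∈⇒elem (∈-upTo⁺ u<n)) (sym (<⇒<ᵇ-true u<n))
... | no u≮n = trans (¬-not (u≮n ∘ ∈-upTo⁻ ∘ elem⇒∈ (upTo n))) (sym (≤⇒<ᵇ-false (≮⇒≥ u≮n)))

elem-remove : ∀ u x ys → elem u (remove x ys) ≡ elem u ys ∧ not (u ≡ᵇ x)
elem-remove u x [] = refl
elem-remove u x (y ∷ ys) with x ≟ y | u ≟ x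
... | yes refl | yes refl
  rewrite ≡ᵇ-refl u | elem-remove u u ys | ≡ᵇ-refl u = ∧-zeroʳ (elem u ys)
... | yes refl | no u≢x
  rewrite ≡ᵇ-refl x | elem-remove u x ys | ≢⇒≡ᵇ-false u≢x = refl
... | no x≢y | yes refl
  rewrite ≢⇒≡ᵇ-false x≢y | elem-remove u u ys | ≡ᵇ-refl u | ≢⇒≡ᵇ-false x≢y = refl
... | no x≢y | no u≢x
  rewrite ≢⇒≡ᵇ-false x≢y | elem-remove u x ys | ≢⇒≡ᵇ-false u≢x
        | ∧-identityʳ (elem u ys) | ∧-identityʳ ((u ≡ᵇ y) ∨ elem u ys) = refl

countBelow : (ℕ → Bool) → ℕ → ℕ
countBelow p n = count p (upTo n)

sumBelow : (ℕ → ℕ) → ℕ → ℕ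
sumBelow f n = sum (map f (upTo n))

countBelow-suc : ∀ p n → countBelow p (suc n) ≡ countBelow p n + (if p n then 1 else 0)
countBelow-suc p n = begin
  count p (upTo (suc n))     ≡⟨ cong (count p) (sym (upTo-∷ʳ n)) ⟩
  count p (upTo n ++ n ∷ []) ≡⟨ count-++ p (upTo n) (n ∷ []) ⟩
  countBelow p n + (if p n then 1 else 0) ∎
  where open ≡-Reasoning

sumBelow-suc : ∀ f n → sumBelow f (suc n) ≡ sumBelow f n + f n
sumBelow-suc f n = begin
  sum (map f (upTo (suc n)))     ≡⟨ cong (sum ∘ map f) (sym (upTo-∷ʳ n)) ⟩
  sum (map f (upTo n ++ n ∷ [])) ≡⟨ cong sum (map-++ f (upTo n) (n ∷ [])) ⟩
  sum (map f (upTo n) ++ f n ∷ []) ≡⟨ sum-++ (map f (upTo n)) (f n ∷ []) ⟩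
  sumBelow f n + (f n + 0)       ≡⟨ cong (sumBelow f n +_) (+-identityʳ (f n)) ⟩
  sumBelow f n + f n ∎
  where open ≡-Reasoning

countBelow-suc-false : ∀ {p} n → p n ≡ false → countBelow p (suc n) ≡ countBelow p n
countBelow-suc-false {p} n pn rewrite countBelow-suc p n | pn = +-identityʳ (countBelow p n)

countBelow-cong : ∀ n → (∀ {u} → u < n → p u ≡ q u) → countBelow p n ≡ countBelow q n
countBelow-cong n eq = count-cong (upTo n) (eq ∘ ∈-upTo⁻)

countBelow-none : ∀ n → (∀ {u} → u < n → p u ≡ false) → countBelow p n ≡ 0
countBelow-none n none = count-none (upTo n) (none ∘ ∈-upTo⁻)

sumBelow-cong : ∀ n → (∀ {u} → u < n → f u ≡ g u) → sumBelow f n ≡ sumBelow g n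
sumBelow-cong n eq = sum-map-cong (upTo n) (eq ∘ ∈-upTo⁻)

countBelow-≡ᵇ : ∀ {x n} → x < n → countBelow (_≡ᵇ x) n ≡ 1
countBelow-≡ᵇ {x} {suc n} x<1+n with x ≟ n
... | yes refl = begin
  countBelow (_≡ᵇ x) (suc x) ≡⟨ countBelow-suc (_≡ᵇ x) x ⟩
  countBelow (_≡ᵇ x) x + (if x ≡ᵇ x then 1 else 0)
    ≡⟨ cong₂ (λ k b → k + (if b then 1 else 0))
             (countBelow-none x (λ u<x → ≢⇒≡ᵇ-false (<⇒≢ u<x))) (≡ᵇ-refl x) ⟩
  1 ∎
  where open ≡-Reasoning
... | no x≢n = begin
  countBelow (_≡ᵇ x) (suc n) ≡⟨ countBelow-suc (_≡ᵇ x) n ⟩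
  countBelow (_≡ᵇ x) n + (if n ≡ᵇ x then 1 else 0)
    ≡⟨ cong₂ (λ k b → k + (if b then 1 else 0))
             (countBelow-≡ᵇ (≤∧≢⇒< (s≤s⁻¹ x<1+n) x≢n)) (≢⇒≡ᵇ-false (x≢n ∘ sym)) ⟩
  1 ∎
  where open ≡-Reasoning

countBelow-remove : ∀ {x n} (p : ℕ → Bool) → x < n → p x ≡ true →
  suc (countBelow (λ u → p u ∧ not (u ≡ᵇ x)) n) ≡ countBelow p n
countBelow-remove {x} {n} p x<n px = begin
  1 + countBelow (λ u → p u ∧ not (u ≡ᵇ x)) n
    ≡⟨ cong (_+ countBelow (λ u → p u ∧ not (u ≡ᵇ x)) n) exactly-x ⟨
  countBelow (λ u → p u ∧ (u ≡ᵇ x)) n + countBelow (λ u → p u ∧ not (u ≡ᵇ x)) n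
    ≡⟨ count-split p (_≡ᵇ x) (upTo n) ⟨
  countBelow p n ∎
  where
  open ≡-Reasoning
  only-x : ∀ u → (p u ∧ (u ≡ᵇ x)) ≡ (u ≡ᵇ x)
  only-x u with u ≟ x
  ... | yes refl rewrite px = refl
  ... | no u≢x rewrite ≢⇒≡ᵇ-false u≢x = ∧-zeroʳ (p u)
  exactly-x : countBelow (λ u → p u ∧ (u ≡ᵇ x)) n ≡ 1
  exactly-x = trans (countBelow-cong n (λ {u} _ → only-x u)) (countBelow-≡ᵇ x<n)

sumBelow-+ : ∀ (f g : ℕ → ℕ) n → sumBelow (λ u → f u + g u) n ≡ sumBelow f n + sumBelow g n
sumBelow-+ f g n = sum-map-+ f g (upTo n)

-- nbrEdges s v is edgesWithin (adj s) (adj s v) (size s) by definition.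
edgesWithin : (ℕ → ℕ → Bool) → (ℕ → Bool) → ℕ → ℕ
edgesWithin A S n = sumBelow (λ u → countBelow (λ w → (u <ᵇ w) ∧ S u ∧ S w ∧ A u w) n) n

edgesWithin-suc : ∀ A S n →
  edgesWithin A S (suc n) ≡ edgesWithin A S n + countBelow (λ u → S u ∧ S n ∧ A u n) n
edgesWithin-suc A S n = begin
  edgesWithin A S (suc n)
    ≡⟨ sumBelow-suc (λ u → countBelow (E u) (suc n)) n ⟩
  sumBelow (λ u → countBelow (E u) (suc n)) n + countBelow (E n) (suc n)
    ≡⟨ cong₂ _+_ (sumBelow-cong n (λ {u} _ → countBelow-suc (E u) n)) last-row-empty ⟩
  sumBelow (λ u → countBelow (E u) n + (if E u n then 1 else 0)) n + 0
    ≡⟨ +-identityʳ _ ⟩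
  sumBelow (λ u → countBelow (E u) n + (if E u n then 1 else 0)) n
    ≡⟨ sumBelow-+ (λ u → countBelow (E u) n) (λ u → if E u n then 1 else 0) n ⟩
  edgesWithin A S n + sumBelow (λ u → if E u n then 1 else 0) n
    ≡⟨ cong (edgesWithin A S n +_) (sum-map-indicator (λ u → E u n) (upTo n)) ⟩
  edgesWithin A S n + countBelow (λ u → E u n) n
    ≡⟨ cong (edgesWithin A S n +_) (countBelow-cong n new-column) ⟩
  edgesWithin A S n + countBelow (λ u → S u ∧ S n ∧ A u n) n ∎
  where
  open ≡-Reasoning
  E : ℕ → ℕ → Bool
  E u w = (u <ᵇ w) ∧ S u ∧ S w ∧ A u w
  last-row-empty : countBelow (E n) (suc n) ≡ 0
  last-row-empty = countBelow-none (suc n) λ {w} w<1+n →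
    cong (_∧ (S n ∧ S w ∧ A n w)) (≤⇒<ᵇ-false (s≤s⁻¹ w<1+n))
  new-column : ∀ {u} → u < n → E u n ≡ (S u ∧ S n ∧ A u n)
  new-column {u} u<n = cong (_∧ (S u ∧ S n ∧ A u n)) (<⇒<ᵇ-true u<n)

edgesWithin-cong : ∀ {A A′ S S′} n →
  (∀ {u w} → u < n → w < n → A u w ≡ A′ u w) → (∀ {u} → u < n → S u ≡ S′ u) →
  edgesWithin A S n ≡ edgesWithin A′ S′ n
edgesWithin-cong {A} {A′} {S} {S′} n A≗A′ S≗S′ =
  sumBelow-cong n λ {u} u<n → countBelow-cong n λ {w} w<n →
    cong₂ (λ a b → (u <ᵇ w) ∧ a ∧ b) (S≗S′ u<n) (cong₂ _∧_ (S≗S′ w<n) (A≗A′ u<n w<n))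

CliqueBelow : (ℕ → ℕ → Bool) → (ℕ → Bool) → ℕ → Set
CliqueBelow A S n = ∀ {u w} → u < w → w < n → S u ≡ true → S w ≡ true → A u w ≡ true

cliqueBelow-pred : ∀ {A S n} → CliqueBelow A S (suc n) → CliqueBelow A S n
cliqueBelow-pred clique u<w w<n = clique u<w (m<n⇒m<1+n w<n)

-- A new member n of S is adjacent to all k = countBelow S n earlier members,
-- so the edge count follows the recurrence of k(k−1)/2.
edgesWithin-clique : ∀ A S n → CliqueBelow A S n →
  2 * edgesWithin A S n + countBelow S n ≡ countBelow S n * countBelow S n
edgesWithin-clique A S zero _ = refl
edgesWithin-clique A S (suc n) clique
  rewrite edgesWithin-suc A S n | countBelow-suc S n with S n in Sn
... | false
  rewrite countBelow-none {p = λ u → S u ∧ false} n (λ {u} _ → ∧-zeroʳ (S u))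
        | +-identityʳ (edgesWithin A S n) | +-identityʳ (countBelow S n)
  = edgesWithin-clique A S n (cliqueBelow-pred clique)
... | true = begin
  2 * (e + countBelow (λ u → S u ∧ A u n) n) + (k + 1)
    ≡⟨ cong (λ j → 2 * (e + j) + (k + 1)) (countBelow-cong n joined) ⟩
  2 * (e + k) + (k + 1)     ≡⟨ regroup e k ⟩
  (2 * e + k) + (2 * k + 1)
    ≡⟨ cong (_+ (2 * k + 1)) (edgesWithin-clique A S n (cliqueBelow-pred clique)) ⟩
  k * k + (2 * k + 1)       ≡⟨ square-suc k ⟩
  (k + 1) * (k + 1) ∎
  where
  open ≡-Reasoning
  e = edgesWithin A S n
  k = countBelow S n
  joined : ∀ {u} → u < n → (S u ∧ A u n) ≡ S u
  joined {u} u<n with S u in Su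
  ... | true = clique u<n ≤-refl Su Sn
  ... | false = refl
  regroup : ∀ e k → 2 * (e + k) + (k + 1) ≡ (2 * e + k) + (2 * k + 1)
  regroup = solve-∀
  square-suc : ∀ k → k * k + (2 * k + 1) ≡ (k + 1) * (k + 1)
  square-suc = solve-∀

-- E = d k − d(d+1)/2 for degree k and E edges among the neighbours, stated
-- without subtraction or division.
record DegreeEdgeLaw (d k e : ℕ) : Set where
  field
    degree-≥ : d + 1 ≤ k
    edges-≡  : 2 * e + d * (d + 1) ≡ 2 * d * k

degreeEdgeLaw-clique : ∀ d e → 2 * e + (d + 1) ≡ (d + 1) * (d + 1) → DegreeEdgeLaw d (d + 1) e
degreeEdgeLaw-clique d e pairs = record
  { degree-≥ = ≤-refl
  ; edges-≡  = +-cancelʳ-≡ (d + 1) _ _ (begin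
      2 * e + d * (d + 1) + (d + 1)   ≡⟨ swap (2 * e) d ⟩
      2 * e + (d + 1) + d * (d + 1)   ≡⟨ cong (_+ d * (d + 1)) pairs ⟩
      (d + 1) * (d + 1) + d * (d + 1) ≡⟨ expand d ⟩
      2 * d * (d + 1) + (d + 1) ∎)
  }
  where
  open ≡-Reasoning
  swap : ∀ a d → a + d * (d + 1) + (d + 1) ≡ a + (d + 1) + d * (d + 1)
  swap = solve-∀
  expand : ∀ d → (d + 1) * (d + 1) + d * (d + 1) ≡ 2 * d * (d + 1) + (d + 1)
  expand = solve-∀

degreeEdgeLaw-join : ∀ {d k e} → DegreeEdgeLaw d k e → DegreeEdgeLaw d (k + 1) (e + d)
degreeEdgeLaw-join {d} {k} {e} law = record
  { degree-≥ = ≤-trans degree-≥ (m≤m+n k 1)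
  ; edges-≡  = begin
      2 * (e + d) + d * (d + 1)   ≡⟨ regroup e d ⟩
      2 * e + d * (d + 1) + 2 * d ≡⟨ cong (_+ 2 * d) edges-≡ ⟩
      2 * d * k + 2 * d           ≡⟨ factor k d ⟩
      2 * d * (k + 1) ∎
  }
  where
  open ≡-Reasoning
  open DegreeEdgeLaw law
  regroup : ∀ e d → 2 * (e + d) + d * (d + 1) ≡ 2 * e + d * (d + 1) + 2 * d
  regroup = solve-∀
  factor : ∀ k d → 2 * d * k + 2 * d ≡ 2 * d * (k + 1)
  factor = solve-∀

degreeEdgeLaw⇒edges : ∀ {d k e} → DegreeEdgeLaw d k e → 2 * e ≡ d * (2 * k ∸ d ∸ 1)
degreeEdgeLaw⇒edges {d} {k} {e} law = begin
  2 * e                             ≡⟨ m+n∸n≡m (2 * e) (d * (d + 1)) ⟨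
  2 * e + d * (d + 1) ∸ d * (d + 1) ≡⟨ cong (_∸ d * (d + 1)) (DegreeEdgeLaw.edges-≡ law) ⟩
  2 * d * k ∸ d * (d + 1)           ≡⟨ cong (_∸ d * (d + 1)) (reassoc d k) ⟩
  d * (2 * k) ∸ d * (d + 1)         ≡⟨ *-distribˡ-∸ d (2 * k) (d + 1) ⟨
  d * (2 * k ∸ (d + 1))             ≡⟨ cong (d *_) (∸-+-assoc (2 * k) d 1) ⟨
  d * (2 * k ∸ d ∸ 1) ∎
  where
  open ≡-Reasoning
  reassoc : ∀ d k → 2 * d * k ≡ d * (2 * k)
  reassoc = solve-∀

VertexLaw : ℕ → State → ℕ → Set
VertexLaw d s v = DegreeEdgeLaw d (degree s v) (nbrEdges s v)

record IsClique (d : ℕ) (s : State) (c : List ℕ) : Set where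
  field
    members-count    : countBelow (λ u → elem u c) (size s) ≡ d + 1
    members-bounded  : ∀ {u} → elem u c ≡ true → u < size s
    members-adjacent : ∀ {u w} → elem u c ≡ true → elem w c ≡ true → u ≢ w → adj s u w ≡ true

  size∉ : elem (size s) c ≡ false
  size∉ = ¬-not (λ size∈ → <-irrefl refl (members-bounded size∈))

record Invariant (d : ℕ) (s : State) : Set where
  field
    adj-boundedˡ   : ∀ {u w} → adj s u w ≡ true → u < size s
    adj-boundedʳ   : ∀ {u w} → adj s u w ≡ true → w < size s
    adj-irrefl     : ∀ u → adj s u u ≡ false
    cliques-valid  : ∀ {c} → c ∈ cliques s → IsClique d s c
    vertices-valid : ∀ {v} → v < size s → VertexLaw d s v

cliqueNeighbourhood⇒vertexLaw : ∀ {d} s v → degree s v ≡ d + 1 →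
  CliqueBelow (adj s) (adj s v) (size s) → VertexLaw d s v
cliqueNeighbourhood⇒vertexLaw {d} s v deg clique =
  subst (λ k → DegreeEdgeLaw d k (nbrEdges s v)) (sym deg)
    (degreeEdgeLaw-clique d (nbrEdges s v)
      (subst (λ k → 2 * nbrEdges s v + k ≡ k * k) deg
        (edgesWithin-clique (adj s) (adj s v) (size s) clique)))

module Initial (d : ℕ) where

  private
    N : ℕ
    N = d + 2

    adj-below : ∀ {u w} → u < N → w < N → adj (initState d) u w ≡ not (u ≡ᵇ w)
    adj-below {u} {w} u<N w<N rewrite <⇒<ᵇ-true u<N | <⇒<ᵇ-true w<N = ∧-identityʳ (not (u ≡ᵇ w))

    all-but-one : ∀ {x} → x < N → countBelow (λ u → not (u ≡ᵇ x)) N ≡ d + 1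
    all-but-one x<N = suc-injective (begin
      suc (countBelow (λ u → not (u ≡ᵇ _)) N) ≡⟨ countBelow-remove (λ _ → true) x<N refl ⟩
      countBelow (λ _ → true) N               ≡⟨ count-true (upTo N) ⟩
      length (upTo N)                         ≡⟨ length-upTo N ⟩
      d + 2                                   ≡⟨ +-suc d 1 ⟩
      suc (d + 1) ∎)
      where open ≡-Reasoning

    removed-isClique : ∀ {x} → x < N → IsClique d (initState d) (remove x (upTo N))
    removed-isClique {x} x<N = record
      { members-count    = trans (countBelow-cong N members-below) (all-but-one x<N)
      ; members-bounded  = bounded
      ; members-adjacent = λ u∈ w∈ u≢w →
          trans (adj-below (bounded u∈) (bounded w∈)) (cong not (≢⇒≡ᵇ-false u≢w))
      }
      where
      members : ∀ u → elem u (remove x (upTo N)) ≡ (u <ᵇ N) ∧ not (u ≡ᵇ x)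
      members u = trans (elem-remove u x (upTo N)) (cong (_∧ not (u ≡ᵇ x)) (elem-upTo u N))
      members-below : ∀ {u} → u < N → elem u (remove x (upTo N)) ≡ not (u ≡ᵇ x)
      members-below {u} u<N = trans (members u) (cong (_∧ not (u ≡ᵇ x)) (<⇒<ᵇ-true u<N))
      bounded : ∀ {u} → elem u (remove x (upTo N)) ≡ true → u < N
      bounded {u} u∈ = <ᵇ-true⇒< (∧-conicalˡ _ _ (trans (sym (members u)) u∈))

    vertexLaw : ∀ {v} → v < N → VertexLaw d (initState d) v
    vertexLaw {v} v<N = cliqueNeighbourhood⇒vertexLaw (initState d) v
      (trans (countBelow-cong N (λ {u} u<N → trans (adj-below v<N u<N) (cong not (≡ᵇ-sym v u))))
             (all-but-one v<N))
      (λ u<w w<N _ _ → trans (adj-below (<-trans u<w w<N) w<N) (cong not (≢⇒≡ᵇ-false (<⇒≢ u<w))))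

  invariant : Invariant d (initState d)
  invariant = record
    { adj-boundedˡ   = λ {u} {w} e → <ᵇ-true⇒< (∧-conicalˡ (u <ᵇ N) _ (∧-conicalʳ (not (u ≡ᵇ w)) _ e))
    ; adj-boundedʳ   = λ {u} {w} e → <ᵇ-true⇒< (∧-conicalʳ (u <ᵇ N) _ (∧-conicalʳ (not (u ≡ᵇ w)) _ e))
    ; adj-irrefl     = λ u → cong (λ b → not b ∧ (u <ᵇ N) ∧ (u <ᵇ N)) (≡ᵇ-refl u)
    ; cliques-valid  = λ c∈ → isClique (∈-map⁻ (λ x → remove x (upTo N)) c∈)
    ; vertices-valid = vertexLaw
    }
    where
    isClique : ∀ {c} → ∃ (λ x → x ∈ upTo N × c ≡ remove x (upTo N)) → IsClique d (initState d) c
    isClique (x , x∈ , refl) = removed-isClique (∈-upTo⁻ x∈)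

module Step {d s} (I : Invariant d s) {c} (C : IsClique d s c) where

  open Invariant I
  open IsClique C

  private
    N : ℕ
    N = size s

    s′ : State
    s′ = step s c

    adj-old : ∀ {u w} → u < N → w < N → adj s′ u w ≡ adj s u w
    adj-old {u} {w} u<N w<N rewrite ≢⇒≡ᵇ-false (<⇒≢ u<N) | ≢⇒≡ᵇ-false (<⇒≢ w<N) = ∨-identityʳ (adj s u w)

    size-isolatedˡ : ∀ w → adj s N w ≡ false
    size-isolatedˡ w = ¬-not (<-irrefl refl ∘ adj-boundedˡ)

    size-isolatedʳ : ∀ u → adj s u N ≡ false
    size-isolatedʳ u = ¬-not (<-irrefl refl ∘ adj-boundedʳ)

    adj-new : ∀ u → adj s′ N u ≡ elem u c
    adj-new u rewrite size-isolatedˡ u | ≡ᵇ-refl N | size∉ | ∧-zeroʳ (u ≡ᵇ N) = ∨-identityʳ (elem u c)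

    adj-to-new : ∀ {v} → v < N → adj s′ v N ≡ elem v c
    adj-to-new {v} v<N rewrite size-isolatedʳ v | ≢⇒≡ᵇ-false (<⇒≢ v<N) | ≡ᵇ-refl N = refl

    adj-mono : ∀ {u w} → adj s u w ≡ true → adj s′ u w ≡ true
    adj-mono e rewrite e = refl

    other-members : ∀ {x} → elem x c ≡ true → countBelow (λ u → elem u c ∧ not (u ≡ᵇ x)) N ≡ d
    other-members x∈ = suc-injective (begin
      suc (countBelow (λ u → elem u c ∧ not (u ≡ᵇ _)) N)
        ≡⟨ countBelow-remove (λ u → elem u c) (members-bounded x∈) x∈ ⟩
      countBelow (λ u → elem u c) N ≡⟨ members-count ⟩
      d + 1                         ≡⟨ +-comm d 1 ⟩
      suc d ∎)
      where open ≡-Reasoning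

    degree-old : ∀ {v} → v < N → degree s′ v ≡ degree s v + (if elem v c then 1 else 0)
    degree-old {v} v<N = trans (countBelow-suc (adj s′ v) N)
      (cong₂ (λ k b → k + (if b then 1 else 0)) (countBelow-cong N (adj-old v<N)) (adj-to-new v<N))

    nbrEdges-old : ∀ {v} → v < N →
      nbrEdges s′ v ≡ nbrEdges s v + countBelow (λ u → adj s v u ∧ elem v c ∧ elem u c) N
    nbrEdges-old {v} v<N = trans (edgesWithin-suc (adj s′) (adj s′ v) N)
      (cong₂ _+_ (edgesWithin-cong N adj-old (adj-old v<N))
                 (countBelow-cong N (λ u<N → cong₂ _∧_ (adj-old v<N u<N)
                                                     (cong₂ _∧_ (adj-to-new v<N) (adj-to-new u<N)))))

    vertexLaw-old : ∀ {v} → v < N → VertexLaw d s v → VertexLaw d s′ v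
    vertexLaw-old {v} v<N law = by-membership (elem v c) refl
      where
      by-membership : ∀ b → elem v c ≡ b → VertexLaw d s′ v
      by-membership false v∉ =
        subst₂ (DegreeEdgeLaw d) (sym degree-same) (sym edges-same) law
        where
        degree-same : degree s′ v ≡ degree s v
        degree-same rewrite degree-old v<N | v∉ = +-identityʳ (degree s v)
        edges-same : nbrEdges s′ v ≡ nbrEdges s v
        edges-same rewrite nbrEdges-old v<N | v∉ =
          trans (cong (nbrEdges s v +_) (countBelow-none N (λ {u} _ → ∧-zeroʳ (adj s v u)))) (+-identityʳ _)
      by-membership true v∈ =
        subst₂ (DegreeEdgeLaw d) (sym degree-suc) (sym edges-+d) (degreeEdgeLaw-join law)
        where
        degree-suc : degree s′ v ≡ degree s v + 1
        degree-suc rewrite degree-old v<N | v∈ = refl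
        joined : ∀ {u} → u < N → (adj s v u ∧ elem u c) ≡ (elem u c ∧ not (u ≡ᵇ v))
        joined {u} _ with u ≟ v | elem u c in u∈
        ... | yes refl | _ rewrite adj-irrefl u | ≡ᵇ-refl u = sym (∧-zeroʳ _)
        ... | no u≢v | true rewrite members-adjacent v∈ u∈ (u≢v ∘ sym) | ≢⇒≡ᵇ-false u≢v = refl
        ... | no u≢v | false = ∧-zeroʳ (adj s v u)
        edges-+d : nbrEdges s′ v ≡ nbrEdges s v + d
        edges-+d rewrite nbrEdges-old v<N | v∈ =
          cong (nbrEdges s v +_) (trans (countBelow-cong N joined) (other-members v∈))

    vertexLaw-new : VertexLaw d s′ N
    vertexLaw-new = cliqueNeighbourhood⇒vertexLaw s′ N
      (trans (countBelow-cong (suc N) (λ {u} _ → adj-new u))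
             (trans (countBelow-suc-false N size∉) members-count))
      (λ {u} {w} u<w _ Nu Nw →
        adj-mono (members-adjacent (trans (sym (adj-new u)) Nu) (trans (sym (adj-new w)) Nw) (<⇒≢ u<w)))

    isClique-old : ∀ {c′} → IsClique d s c′ → IsClique d s′ c′
    isClique-old C′ = record
      { members-count    = trans (countBelow-suc-false N (IsClique.size∉ C′)) (IsClique.members-count C′)
      ; members-bounded  = m<n⇒m<1+n ∘ IsClique.members-bounded C′
      ; members-adjacent = λ u∈ w∈ u≢w → adj-mono (IsClique.members-adjacent C′ u∈ w∈ u≢w)
      }

    isClique-new : ∀ {x} → elem x c ≡ true → IsClique d s′ (N ∷ remove x c)
    isClique-new {x} x∈ = record
      { members-count    = begin
          countBelow (λ u → elem u (N ∷ remove x c)) (suc N)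
            ≡⟨ countBelow-suc (λ u → elem u (N ∷ remove x c)) N ⟩
          countBelow (λ u → elem u (N ∷ remove x c)) N + (if elem N (N ∷ remove x c) then 1 else 0)
            ≡⟨ cong₂ (λ k b → k + (if b then 1 else 0))
                     (trans (countBelow-cong N members-below) (other-members x∈))
                     (cong (_∨ elem N (remove x c)) (≡ᵇ-refl N)) ⟩
          d + 1 ∎
      ; members-bounded  = bounded
      ; members-adjacent = adjacent
      }
      where
      open ≡-Reasoning
      members-below : ∀ {u} → u < N → elem u (N ∷ remove x c) ≡ (elem u c ∧ not (u ≡ᵇ x))
      members-below {u} u<N rewrite ≢⇒≡ᵇ-false (<⇒≢ u<N) = elem-remove u x c
      old-member : ∀ {u} → u ≢ N → elem u (N ∷ remove x c) ≡ true → elem u c ≡ true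
      old-member {u} u≢N u∈ rewrite ≢⇒≡ᵇ-false u≢N | elem-remove u x c = ∧-conicalˡ _ _ u∈
      bounded : ∀ {u} → elem u (N ∷ remove x c) ≡ true → u < suc N
      bounded {u} u∈ with u ≟ N
      ... | yes refl = n<1+n N
      ... | no u≢N = m<n⇒m<1+n (members-bounded (old-member u≢N u∈))
      adjacent : ∀ {u w} → elem u (N ∷ remove x c) ≡ true → elem w (N ∷ remove x c) ≡ true → u ≢ w →
        adj s′ u w ≡ true
      adjacent {u} {w} u∈ w∈ u≢w with u ≟ N | w ≟ N
      ... | yes refl | yes refl = ⊥-elim (u≢w refl)
      ... | yes refl | no w≢N = trans (adj-new w) (old-member w≢N w∈)
      ... | no u≢N | yes refl =
        trans (adj-to-new (members-bounded (old-member u≢N u∈))) (old-member u≢N u∈)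
      ... | no u≢N | no w≢N = adj-mono (members-adjacent (old-member u≢N u∈) (old-member w≢N w∈) u≢w)

  invariant : Invariant d (step s c)
  invariant = record
    { adj-boundedˡ   = boundedˡ
    ; adj-boundedʳ   = boundedʳ
    ; adj-irrefl     = irrefl
    ; cliques-valid  = isClique
    ; vertices-valid = vertexLaw
    }
    where
    boundedˡ : ∀ {u w} → adj s′ u w ≡ true → u < suc N
    boundedˡ {u} {w} e with adj s u w in a | u ≟ N
    ... | true  | _        = m<n⇒m<1+n (adj-boundedˡ a)
    ... | false | yes refl = n<1+n N
    ... | false | no u≢N rewrite ≢⇒≡ᵇ-false u≢N = m<n⇒m<1+n (members-bounded (∧-conicalʳ _ _ e))
    boundedʳ : ∀ {u w} → adj s′ u w ≡ true → w < suc N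
    boundedʳ {u} {w} e with adj s u w in a | w ≟ N
    ... | true  | _        = m<n⇒m<1+n (adj-boundedʳ a)
    ... | false | yes refl = n<1+n N
    ... | false | no w≢N rewrite ≢⇒≡ᵇ-false w≢N =
      m<n⇒m<1+n (members-bounded (∧-conicalʳ _ _ (trans (sym (∨-identityʳ _)) e)))
    irrefl : ∀ u → adj s′ u u ≡ false
    irrefl u with u ≟ N
    ... | yes refl rewrite adj-irrefl N | ≡ᵇ-refl N | size∉ = refl
    ... | no u≢N rewrite adj-irrefl u | ≢⇒≡ᵇ-false u≢N = refl
    isClique : ∀ {c′} → c′ ∈ cliques s′ → IsClique d s′ c′
    isClique c′∈ with ∈-++⁻ (cliques s) c′∈
    ... | inj₁ c′∈old = isClique-old (cliques-valid c′∈old)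
    ... | inj₂ c′∈new with ∈-map⁻ (λ x → N ∷ remove x c) c′∈new
    ...   | x , x∈c , refl = isClique-new (∈⇒elem x∈c)
    vertexLaw : ∀ {v} → v < suc N → VertexLaw d s′ v
    vertexLaw {v} v<1+N with v ≟ N
    ... | yes refl = vertexLaw-new
    ... | no v≢N = vertexLaw-old v<N (vertices-valid v<N)
      where v<N = ≤∧≢⇒< (s≤s⁻¹ v<1+N) v≢N

invariant : ∀ {d t s} → PRAN d t s → Invariant d s
invariant start = Initial.invariant _
invariant (grow c run c∈) = Step.invariant I (Invariant.cliques-valid I c∈)
  where I = invariant run

clustering-≡ : ∀ s v {k} → degree s v ≡ suc (suc k) →
  clustering s v ≡ ℤ.+ (2 * nbrEdges s v) / (suc (suc k) * suc k)
clustering-≡ s v eq with degree s v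
clustering-≡ s v refl | _ = refl

mainTheorem5 : (d : ℕ) → 1 ≤ d → (t : ℕ) → (G : State) → PRAN d t G →
    (v : ℕ) → v < size G →
      (d + 1 ≤ degree G v) × (clustering G v ≡ Cformula d (degree G v))
mainTheorem5 d 1≤d t G run v v<n = degree-≥ , clustering-law (degree G v) 2≤degree refl
  where
  law : VertexLaw d G v
  law = Invariant.vertices-valid (invariant run) v<n
  open DegreeEdgeLaw law
  2≤degree : 2 ≤ degree G v
  2≤degree = ≤-trans (+-monoˡ-≤ 1 1≤d) degree-≥
  clustering-law : ∀ k → 2 ≤ k → degree G v ≡ k → clustering G v ≡ Cformula d k
  clustering-law 1 (s≤s ()) _
  clustering-law (suc (suc k)) _ eq = trans (clustering-≡ G v eq)
    (cong (λ e → ℤ.+ e / (suc (suc k) * suc k))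
          (trans (degreeEdgeLaw⇒edges law) (cong (λ j → d * (2 * j ∸ d ∸ 1)) eq)))
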